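{- Let $k\ge 0$. There exists a perfect acyclic matching on the subposet $\bigsqcup_{s\in[k+4]}\bigsqcup_{u\in J_s}B_k^{s,u}$ of the face poset of $\mathcal{N}(S_{3,k})$.
   Context: For a positive integer $n$, $[n]=\{1,\dots,n\}$; arithmetic on $[k+6]$ is mod $k+6$ with representatives in $[k+6]$. $KG_{3,k}$ has as vertices the $3$-element subsets of $[k+6]$, adjacent iff disjoint. A vertex $v$ is stable if there is no $t\in[k+6]$ with $\{t,t+1\}\subseteq v$ (mod $k+6$), unstable otherwise. $S_{3,k}$ has the same vertices as $KG_{3,k}$ and the edges of $KG_{3,k}$ with at least one stable endpoint. $\mathcal{N}(S_{3,k})$ is its neighborhood complex (simplices: nonempty vertex sets with a common neighbor in $S_{3,k}$); the face poset is the set of simplices ordered by inclusion. For a set $\sigma$ of vertices, $C_\sigma=[k+6]\setminus\bigcup_{\alpha\in\sigma}\alpha$. For $s\in[k+6]$: $J_s=[k+5]\setminus[2]$ if $s=1$, $J_s=[k+6]\setminus[s+1]$ if $1<s<k+5$, and $J_s=\emptyset$ otherwise; for $u\in J_s$, $B_k^{s,u}=\{\sigma\in\mathcal{N}(S_{3,k}) : C_\sigma=\{s,s+1,u,u+1\}\}$. A matching on a poset $P$ is a set $M$ of pairs $(a,b)$ with $b$ covering $a$, each element in at most one pair; writing $u(a)=b$, it is acyclic if there are no distinct $a_1,\dots,a_m$, $m\ge2$, with $a_1\prec u(a_1)\succ a_2\prec\cdots\prec u(a_m)\succ a_1$; it is perfect if every element of $P$ is in some pair. -}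

module Defs where

open import Data.Nat using (ℕ; zero; suc; _+_; _∸_; _≤_; _<_)
open import Data.Nat.DivMod using (_%_; m%n<n)
open import Data.Fin using (Fin; fromℕ<; toℕ)
open import Data.Fin.Subset using (Subset; _∈_; ∣_∣)
open import Data.Bool using (Bool; true; false; T)
open import Data.Vec using ([]; _∷_)
open import Data.Product using (Σ; ∃; ∃-syntax; _×_; _,_)
open import Data.Sum using (_⊎_)
open import Data.Empty using (⊥)
open import Relation.Nullary using (¬_)
open import Relation.Binary.PropositionalEquality using (_≡_; _≢_)

-- Ground set [k+6].  Paper label p ∈ {1,…,k+6} is the index p-1 : Fin (k+6).

N : ℕ → ℕ
N k = 6 + k

sucMod : ∀ {m} → Fin (suc m) → Fin (suc m)
sucMod {m} i = fromℕ< (m%n<n (suc (toℕ i)) (suc m))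

pt : (k : ℕ) → ℕ → Fin (N k)
pt k p = fromℕ< (m%n<n (p ∸ 1) (N k))

-- Finite sets of subsets of [n], represented canonically as binary tries
-- (so that propositional equality is equality of sets).

Family : ℕ → Set
Family zero    = Bool
Family (suc n) = Family n × Family n

infix 4 _∈F_
_∈F_ : ∀ {n} → Subset n → Family n → Set
_∈F_ {zero}  []          b         = T b
_∈F_ {suc n} (false ∷ v) (f₀ , f₁) = v ∈F f₀
_∈F_ {suc n} (true  ∷ v) (f₀ , f₁) = v ∈F f₁

infix 4 _⊆F_ _⊂F_
_⊆F_ : ∀ {n} → Family n → Family n → Set
σ ⊆F τ = ∀ v → v ∈F σ → v ∈F τ

_⊂F_ : ∀ {n} → Family n → Family n → Set
σ ⊂F τ = σ ⊆F τ × σ ≢ τ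

IsVertex : (k : ℕ) → Subset (N k) → Set
IsVertex k v = ∣ v ∣ ≡ 3

Stable : (k : ℕ) → Subset (N k) → Set
Stable k v = ¬ (Σ (Fin (N k)) λ t → t ∈ v × sucMod t ∈ v)

Disjoint : ∀ {n} → Subset n → Subset n → Set
Disjoint v w = ∀ i → i ∈ v → i ∈ w → ⊥

AdjS : (k : ℕ) → Subset (N k) → Subset (N k) → Set
AdjS k v w = IsVertex k v × IsVertex k w × Disjoint v w × (Stable k v ⊎ Stable k w)

IsSimplex : (k : ℕ) → Family (N k) → Set
IsSimplex k σ =
  (∀ v → v ∈F σ → IsVertex k v) ×
  (∃[ v ] v ∈F σ) ×
  (∃[ w ] (∀ v → v ∈F σ → AdjS k v w))

InC : (k : ℕ) → Family (N k) → Fin (N k) → Set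
InC k σ i = ¬ (∃[ v ] (v ∈F σ × i ∈ v))

InJ : (k s u : ℕ) → Set
InJ k s u =
  (s ≡ 1 × 3 ≤ u × u ≤ k + 5) ⊎
  (1 < s × s < k + 5 × s + 2 ≤ u × u ≤ k + 6)

InB : (k s u : ℕ) → Family (N k) → Set
InB k s u σ =
  IsSimplex k σ ×
  (∀ i → (InC k σ i → (i ≡ pt k s ⊎ i ≡ pt k (s + 1) ⊎ i ≡ pt k u ⊎ i ≡ pt k (u + 1)))
       × ((i ≡ pt k s ⊎ i ≡ pt k (s + 1) ⊎ i ≡ pt k u ⊎ i ≡ pt k (u + 1)) → InC k σ i))

InP : (k : ℕ) → Family (N k) → Set
InP k σ = Σ ℕ λ s → Σ ℕ λ u → (1 ≤ s × s ≤ k + 4) × InJ k s u × InB k s u σ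

module _ {n : ℕ} (P : Family n → Set) where

  Covers : Family n → Family n → Set
  Covers a b = P a × P b × a ⊂F b ×
               (∀ c → P c → a ⊂F c → c ⊂F b → ⊥)

  IsMatching : (Family n → Family n → Set) → Set
  IsMatching M =
    (∀ a b → M a b → Covers a b) ×
    (∀ a b a′ b′ x → M a b → M a′ b′ →
       (x ≡ a ⊎ x ≡ b) → (x ≡ a′ ⊎ x ≡ b′) → (a ≡ a′ × b ≡ b′))

  IsPerfect : (Family n → Family n → Set) → Set
  IsPerfect M = ∀ a → P a → ∃[ b ] (M a b ⊎ M b a)

  IsAcyclic : (Family n → Family n → Set) → Set
  IsAcyclic M =
    ∀ (m : ℕ) (a b : Fin (suc (suc m)) → Family n) →
      (∀ i j → a i ≡ a j → i ≡ j) →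
      (∀ i → M (a i) (b i)) →
      (∀ i → Covers (a (sucMod i)) (b i)) →
      ⊥

  IsPerfectAcyclicMatching : (Family n → Family n → Set) → Set
  IsPerfectAcyclicMatching M = IsMatching M × IsPerfect M × IsAcyclic M

module Submission where

-- For σ ∈ P let X(σ) = [k+6] ∖ C_σ be the set of points covered by σ.  A common neighbour w
-- of σ lies in C_σ = {s, s+1, u, u+1}; such a 3-set is never stable, so every vertex of σ is
-- stable.  Hence the fibre of P over X is exactly the poset 𝒞(X) of nonempty families of
-- stable 3-subsets of X whose union is X, and matched pairs and cycles never leave a fibre.
--
-- On 𝒞(X) the matching is built by recursion on X.  A pivot of X is a point a ∈ X with
-- a+1 ∈ X and a-1 ∉ X.  Split σ into the vertices through a and the rest ρ.  If ρ covers
-- X ∖ a, match σ through the (recursively constructed) matching of ρ in 𝒞(X ∖ a), keeping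
-- the vertices through a fixed; otherwise toggle a vertex t(ρ) through a, obtained from a
-- vertex of ρ through a+1 by replacing a+1 with a.  Every step preserves being a "good"
-- matching (pairs are one-vertex extensions; functional; injective; no family is both a
-- top and a bottom; acyclic).  The matching is perfect as long as X misses a point and has
-- at most two maximal runs: without a pivot X then has at most two points, and 𝒞(X) = ∅.

open import Defs
open import Data.Nat using (ℕ; zero; suc; _+_; _∸_; _≤_; _<_; _<?_; z≤n; s≤s; NonZero)
open import Data.Nat.Properties
open import Data.Nat.DivMod using (_%_; m%n<n; %-distribˡ-+; m%n%n≡m%n; m<n⇒m%n≡m; [m+n]%n≡m%n; n%n≡0)
open import Data.Bool using (true; false)
open import Data.Bool.Properties using (T?) renaming (_≟_ to _≟B_)
open import Data.Fin as F using (Fin; toℕ)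
open import Data.Fin.Properties using (toℕ-fromℕ<; toℕ-injective; toℕ<n; any?; all?; ¬∀⟶∃¬)
open import Data.Fin.Subset using (Subset; _∈_; _∉_; ∣_∣; ⁅_⁆; _∪_; _-_)
open import Data.Fin.Subset.Properties as SP using (p⊆q⇒∣p∣≤∣q∣; ∣⁅x⁆∣≡1; x∈p∪q⁺; x∈⁅x⁆; _∈?_; anySubset?; ∣p∣≤n)
open import Data.Vec using ([]; _∷_; lookup; _[_]≔_; replicate; tabulate)
import Data.Vec.Properties as VP
open import Data.Vec.Base using (there)
open import Data.Product using (Σ; ∃; ∃-syntax; _×_; _,_; proj₁; proj₂)
open import Data.Sum using (_⊎_; inj₁; inj₂)
open import Data.Empty using (⊥; ⊥-elim)
open import Data.Unit using (tt)
open import Relation.Nullary using (¬_; Dec; yes; no; does)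
open import Relation.Nullary.Decidable using (_×-dec_; _⊎-dec_; ¬?; _→-dec_; dec-true)
open import Relation.Binary.PropositionalEquality hiding (J)

_≟ₛ_ : ∀ {n} (v w : Subset n) → Dec (v ≡ w)
_≟ₛ_ = VP.≡-dec _≟B_

_∈F?_ : ∀ {n} (v : Subset n) (σ : Family n) → Dec (v ∈F σ)
_∈F?_ {zero}  []          b         = T? b
_∈F?_ {suc n} (false ∷ v) (f₀ , f₁) = v ∈F? f₀
_∈F?_ {suc n} (true  ∷ v) (f₀ , f₁) = v ∈F? f₁

-- Families are extensional: the trie representation is canonical.
family-ext : ∀ {n} {σ τ : Family n} → σ ⊆F τ → τ ⊆F σ → σ ≡ τ
family-ext {zero}  {false} {false} _ _ = refl
family-ext {zero}  {false} {true}  _ g = ⊥-elim (g [] tt)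
family-ext {zero}  {true}  {false} f _ = ⊥-elim (f [] tt)
family-ext {zero}  {true}  {true}  _ _ = refl
family-ext {suc n} {_ , _} {_ , _} f g =
  cong₂ _,_ (family-ext (λ v → f (false ∷ v)) (λ v → g (false ∷ v)))
            (family-ext (λ v → f (true ∷ v)) (λ v → g (true ∷ v)))

⊆F-refl : ∀ {n} {σ τ : Family n} → σ ≡ τ → σ ⊆F τ
⊆F-refl refl v h = h

⊆F-trans : ∀ {n} {σ τ υ : Family n} → σ ⊆F τ → τ ⊆F υ → σ ⊆F υ
⊆F-trans s t v h = t v (s v h)

familyOf : ∀ {n} (Q : Subset n → Set) → (∀ v → Dec (Q v)) → Family n
familyOf {zero}  Q d = does (d [])
familyOf {suc n} Q d = familyOf (λ v → Q (false ∷ v)) (λ v → d (false ∷ v)) ,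
                       familyOf (λ v → Q (true ∷ v)) (λ v → d (true ∷ v))

familyOf⁺ : ∀ {n} (Q : Subset n → Set) d (v : Subset n) → Q v → v ∈F familyOf Q d
familyOf⁺ {zero} Q d [] q with d []
... | yes _ = tt
... | no ¬q = ¬q q
familyOf⁺ {suc n} Q d (false ∷ v) q = familyOf⁺ (λ w → Q (false ∷ w)) _ v q
familyOf⁺ {suc n} Q d (true ∷ v)  q = familyOf⁺ (λ w → Q (true ∷ w)) _ v q

familyOf⁻ : ∀ {n} (Q : Subset n → Set) d (v : Subset n) → v ∈F familyOf Q d → Q v
familyOf⁻ {zero} Q d [] q with d []
... | yes p = p
... | no _  = ⊥-elim q
familyOf⁻ {suc n} Q d (false ∷ v) q = familyOf⁻ (λ w → Q (false ∷ w)) _ v q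
familyOf⁻ {suc n} Q d (true ∷ v)  q = familyOf⁻ (λ w → Q (true ∷ w)) _ v q

module _ {n : ℕ} where

  insert : Subset n → Family n → Family n
  insert t σ = familyOf (λ v → v ≡ t ⊎ v ∈F σ) (λ v → (v ≟ₛ t) ⊎-dec (v ∈F? σ))

  remove : Subset n → Family n → Family n
  remove t σ = familyOf (λ v → v ≢ t × v ∈F σ) (λ v → ¬? (v ≟ₛ t) ×-dec (v ∈F? σ))

  filterF : (Q : Subset n → Set) → (∀ v → Dec (Q v)) → Family n → Family n
  filterF Q d σ = familyOf (λ v → Q v × v ∈F σ) (λ v → d v ×-dec (v ∈F? σ))

  unionF : Family n → Family n → Family n
  unionF σ τ = familyOf (λ v → v ∈F σ ⊎ v ∈F τ) (λ v → (v ∈F? σ) ⊎-dec (v ∈F? τ))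

  insert-⊆ : ∀ t σ → σ ⊆F insert t σ
  insert-⊆ t σ v h = familyOf⁺ (λ w → w ≡ t ⊎ w ∈F σ) _ v (inj₂ h)

  insert-∋ : ∀ t σ → t ∈F insert t σ
  insert-∋ t σ = familyOf⁺ (λ w → w ≡ t ⊎ w ∈F σ) _ t (inj₁ refl)

  insert⁻ : ∀ t σ v → v ∈F insert t σ → v ≡ t ⊎ v ∈F σ
  insert⁻ t σ = familyOf⁻ (λ w → w ≡ t ⊎ w ∈F σ) _

  remove⁺ : ∀ t σ v → v ≢ t → v ∈F σ → v ∈F remove t σ
  remove⁺ t σ v ne h = familyOf⁺ (λ w → w ≢ t × w ∈F σ) _ v (ne , h)

  remove⁻ : ∀ t σ v → v ∈F remove t σ → v ≢ t × v ∈F σ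
  remove⁻ t σ = familyOf⁻ (λ w → w ≢ t × w ∈F σ) _

  filterF⁺ : ∀ Q d σ v → Q v → v ∈F σ → v ∈F filterF Q d σ
  filterF⁺ Q d σ v q h = familyOf⁺ (λ w → Q w × w ∈F σ) _ v (q , h)

  filterF⁻ : ∀ Q d σ v → v ∈F filterF Q d σ → Q v × v ∈F σ
  filterF⁻ Q d σ = familyOf⁻ (λ w → Q w × w ∈F σ) _

  unionF⁺ : ∀ σ τ v → v ∈F σ ⊎ v ∈F τ → v ∈F unionF σ τ
  unionF⁺ σ τ = familyOf⁺ (λ w → w ∈F σ ⊎ w ∈F τ) _

  unionF⁻ : ∀ σ τ v → v ∈F unionF σ τ → v ∈F σ ⊎ v ∈F τ
  unionF⁻ σ τ = familyOf⁻ (λ w → w ∈F σ ⊎ w ∈F τ) _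

  insert-≢ : ∀ t σ → ¬ (t ∈F σ) → σ ≢ insert t σ
  insert-≢ t σ tn e = tn (subst (t ∈F_) (sym e) (insert-∋ t σ))

  insert-cancel : ∀ t σ τ → ¬ (t ∈F σ) → ¬ (t ∈F τ) → insert t σ ≡ insert t τ → σ ≡ τ
  insert-cancel t σ τ tσ tτ e = family-ext (half σ τ tσ e) (half τ σ tτ (sym e))
    where
    half : ∀ σ τ → ¬ (t ∈F σ) → insert t σ ≡ insert t τ → σ ⊆F τ
    half σ τ tσ e v h with insert⁻ t τ v (subst (v ∈F_) e (insert-⊆ t σ v h))
    ... | inj₁ refl = ⊥-elim (tσ h)
    ... | inj₂ h′   = h′

  insert-sandwich : ∀ t σ τ → σ ⊆F τ → τ ⊆F insert t σ → τ ≡ σ ⊎ τ ≡ insert t σ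
  insert-sandwich t σ τ στ τi with t ∈F? τ
  ... | yes tτ = inj₂ (family-ext τi back)
    where
    back : insert t σ ⊆F τ
    back v h with insert⁻ t σ v h
    ... | inj₁ refl = tτ
    ... | inj₂ vσ   = στ v vσ
  ... | no ¬tτ = inj₁ (family-ext down στ)
    where
    down : τ ⊆F σ
    down v h with insert⁻ t σ v (τi v h)
    ... | inj₁ refl = ⊥-elim (¬tτ h)
    ... | inj₂ vσ   = vσ

  insert-remove : ∀ t σ → t ∈F σ → σ ≡ insert t (remove t σ)
  insert-remove t σ tσ = family-ext forth back
    where
    forth : σ ⊆F insert t (remove t σ)
    forth v h with v ≟ₛ t
    ... | yes refl = insert-∋ t (remove t σ)
    ... | no ne    = insert-⊆ t (remove t σ) v (remove⁺ t σ v ne h)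
    back : insert t (remove t σ) ⊆F σ
    back v h with insert⁻ t (remove t σ) v h
    ... | inj₁ refl = tσ
    ... | inj₂ x    = proj₂ (remove⁻ t σ v x)

-- Arithmetic on ℤ/n (n ≥ 2) through the cyclic successor sucMod.

suc-%-absorb : ∀ x d .{{_ : NonZero d}} → suc (x % d) % d ≡ suc x % d
suc-%-absorb x d = begin
  (1 + x % d) % d         ≡⟨ %-distribˡ-+ 1 (x % d) d ⟩
  (1 % d + x % d % d) % d ≡⟨ cong (λ z → (1 % d + z) % d) (m%n%n≡m%n x d) ⟩
  (1 % d + x % d) % d     ≡⟨ sym (%-distribˡ-+ 1 x d) ⟩
  (1 + x) % d             ∎
  where open ≡-Reasoning

-- Throughout, n = m + 2, so that the successor has no fixed point.
module Cyclic (m : ℕ) where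
  n : ℕ
  n = suc (suc m)

  toℕ-sucMod : (i : Fin n) → toℕ (sucMod i) ≡ suc (toℕ i) % n
  toℕ-sucMod i = toℕ-fromℕ< _

  sucMod^ : ℕ → Fin n → Fin n
  sucMod^ zero    i = i
  sucMod^ (suc d) i = sucMod (sucMod^ d i)

  toℕ-sucMod^ : ∀ d i → toℕ (sucMod^ d i) ≡ (toℕ i + d) % n
  toℕ-sucMod^ zero i = begin
    toℕ i           ≡⟨ sym (m<n⇒m%n≡m (toℕ<n i)) ⟩
    toℕ i % n       ≡⟨ cong (_% n) (sym (+-identityʳ (toℕ i))) ⟩
    (toℕ i + 0) % n ∎
    where open ≡-Reasoning
  toℕ-sucMod^ (suc d) i = begin
    toℕ (sucMod (sucMod^ d i)) ≡⟨ toℕ-sucMod (sucMod^ d i) ⟩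
    suc (toℕ (sucMod^ d i)) % n ≡⟨ cong (λ z → suc z % n) (toℕ-sucMod^ d i) ⟩
    suc ((toℕ i + d) % n) % n   ≡⟨ suc-%-absorb (toℕ i + d) n ⟩
    suc (toℕ i + d) % n         ≡⟨ cong (_% n) (sym (+-suc (toℕ i) d)) ⟩
    (toℕ i + suc d) % n         ∎
    where open ≡-Reasoning

  sucMod^-reaches : ∀ i j → ∃[ d ] sucMod^ d i ≡ j
  sucMod^-reaches i j = (n ∸ toℕ i) + toℕ j , toℕ-injective (begin
    toℕ (sucMod^ ((n ∸ toℕ i) + toℕ j) i) ≡⟨ toℕ-sucMod^ _ i ⟩
    (toℕ i + ((n ∸ toℕ i) + toℕ j)) % n    ≡⟨ cong (_% n) (sym (+-assoc (toℕ i) _ _)) ⟩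
    (toℕ i + (n ∸ toℕ i) + toℕ j) % n      ≡⟨ cong (λ z → (z + toℕ j) % n) (m+[n∸m]≡n (<⇒≤ (toℕ<n i))) ⟩
    (n + toℕ j) % n                        ≡⟨ cong (_% n) (+-comm n (toℕ j)) ⟩
    (toℕ j + n) % n                        ≡⟨ [m+n]%n≡m%n (toℕ j) n ⟩
    toℕ j % n                              ≡⟨ m<n⇒m%n≡m (toℕ<n j) ⟩
    toℕ j                                  ∎)
    where open ≡-Reasoning

  -- The predecessor: n - 1 steps forward.
  predMod : Fin n → Fin n
  predMod = sucMod^ (suc m)

  sucMod-predMod : ∀ i → sucMod (predMod i) ≡ i
  sucMod-predMod i = toℕ-injective (begin
    toℕ (sucMod^ n i) ≡⟨ toℕ-sucMod^ n i ⟩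
    (toℕ i + n) % n   ≡⟨ [m+n]%n≡m%n (toℕ i) n ⟩
    toℕ i % n         ≡⟨ m<n⇒m%n≡m (toℕ<n i) ⟩
    toℕ i             ∎)
    where open ≡-Reasoning

  private
    wrap-cases : ∀ x → x < n → (suc x < n × suc x % n ≡ suc x) ⊎ (suc x ≡ n × suc x % n ≡ 0)
    wrap-cases x x<n with suc x <? n
    ... | yes p = inj₁ (p , m<n⇒m%n≡m p)
    ... | no ¬p = let e = ≤-antisym x<n (≮⇒≥ ¬p) in inj₂ (e , trans (cong (_% n) e) (n%n≡0 n))

  sucMod-injective : ∀ {i j} → sucMod i ≡ sucMod j → i ≡ j
  sucMod-injective {i} {j} eq =
    toℕ-injective (cases (wrap-cases (toℕ i) (toℕ<n i)) (wrap-cases (toℕ j) (toℕ<n j)))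
    where
    e : suc (toℕ i) % n ≡ suc (toℕ j) % n
    e = trans (sym (toℕ-sucMod i)) (trans (cong toℕ eq) (toℕ-sucMod j))
    cases : _ → _ → toℕ i ≡ toℕ j
    cases (inj₁ (_ , a)) (inj₁ (_ , b)) = suc-injective (trans (sym a) (trans e b))
    cases (inj₁ (_ , a)) (inj₂ (_ , b)) with trans (sym a) (trans e b)
    ... | ()
    cases (inj₂ (_ , a)) (inj₁ (_ , b)) with trans (sym b) (trans (sym e) a)
    ... | ()
    cases (inj₂ (a , _)) (inj₂ (b , _)) = suc-injective (trans a (sym b))

  sucMod-≢ : ∀ i → sucMod i ≢ i
  sucMod-≢ i eq with wrap-cases (toℕ i) (toℕ<n i)
  ... | inj₁ (_ , a) = 1+n≢n (trans (sym a) (trans (sym (toℕ-sucMod i)) (cong toℕ eq)))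
  ... | inj₂ (a , b) = 1+n≢0 {m} (suc-injective (trans (sym a) (cong suc (sym z))))
    where
    z : 0 ≡ toℕ i
    z = trans (sym b) (trans (sym (toℕ-sucMod i)) (cong toℕ eq))

  around-the-cycle : (P : Fin n → Set) → (∀ i → P i → P (sucMod i)) → ∀ i j → P i → P j
  around-the-cycle P step i j p with sucMod^-reaches i j
  ... | d , refl = iterate d
    where
    iterate : ∀ d → P (sucMod^ d i)
    iterate zero    = p
    iterate (suc d) = step _ (iterate d)

  cyclic-descent : {A : Set} (_≼_ : A → A → Set) → (∀ {x y z} → x ≼ y → y ≼ z → x ≼ z) →
                   (f : Fin n → A) → (∀ i → f (sucMod i) ≼ f i) →
                   (∀ {i} → f i ≼ f i) → ∀ i j → f j ≼ f i
  cyclic-descent _≼_ trans≼ f down refl≼ i j =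
    around-the-cycle (λ j → f j ≼ f i) (λ j h → trans≼ (down j) h) i j refl≼

  descending-families-constant : ∀ {k} (f : Fin n → Family k) → (∀ i → f (sucMod i) ⊆F f i) →
                                 ∀ i j → f i ≡ f j
  descending-families-constant f down i j = family-ext (below j i) (below i j)
    where
    below : ∀ i j → f j ⊆F f i
    below = cyclic-descent _⊆F_ ⊆F-trans f down (λ v h → h)

∈⇒lookup : ∀ {n} {i : Fin n} {p : Subset n} → i ∈ p → lookup p i ≡ true
∈⇒lookup = VP.[]=⇒lookup

lookup⇒∈ : ∀ {n} {i : Fin n} {p : Subset n} → lookup p i ≡ true → i ∈ p
lookup⇒∈ {i = i} {p} = VP.lookup⇒[]= i p

subsetOf : ∀ {n} {P : Fin n → Set} → (∀ i → Dec (P i)) → Subset n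
subsetOf P? = tabulate (λ i → does (P? i))

subsetOf⁺ : ∀ {n} {P : Fin n → Set} (P? : ∀ i → Dec (P i)) {i} → P i → i ∈ subsetOf P?
subsetOf⁺ P? {i} p = lookup⇒∈ (trans (VP.lookup∘tabulate (λ j → does (P? j)) i) (dec-true (P? i) p))

subsetOf⁻ : ∀ {n} {P : Fin n → Set} (P? : ∀ i → Dec (P i)) {i} → i ∈ subsetOf P? → P i
subsetOf⁻ P? {i} h = from-does (P? i) (trans (sym (VP.lookup∘tabulate (λ j → does (P? j)) i)) (∈⇒lookup h))
  where
  from-does : ∀ {A : Set} (a? : Dec A) → does a? ≡ true → A
  from-does (yes a) _ = a
  from-does (no _) ()

∣set-true∣ : ∀ {n} (v : Subset n) i → lookup v i ≡ false → ∣ v [ i ]≔ true ∣ ≡ suc ∣ v ∣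
∣set-true∣ (false ∷ v) F.zero    e = refl
∣set-true∣ (true ∷ v)  F.zero    ()
∣set-true∣ (false ∷ v) (F.suc i) e = ∣set-true∣ v i e
∣set-true∣ (true ∷ v)  (F.suc i) e = cong suc (∣set-true∣ v i e)

∣set-false∣ : ∀ {n} (v : Subset n) i → lookup v i ≡ true → suc ∣ v [ i ]≔ false ∣ ≡ ∣ v ∣
∣set-false∣ (true ∷ v)  F.zero    e = refl
∣set-false∣ (false ∷ v) F.zero    ()
∣set-false∣ (false ∷ v) (F.suc i) e = ∣set-false∣ v i e
∣set-false∣ (true ∷ v)  (F.suc i) e = cong suc (∣set-false∣ v i e)

∣p∪q∣≤∣p∣+∣q∣ : ∀ {n} (p q : Subset n) → ∣ p ∪ q ∣ ≤ ∣ p ∣ + ∣ q ∣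
∣p∪q∣≤∣p∣+∣q∣ [] [] = z≤n
∣p∪q∣≤∣p∣+∣q∣ (false ∷ p) (false ∷ q) = ∣p∪q∣≤∣p∣+∣q∣ p q
∣p∪q∣≤∣p∣+∣q∣ (false ∷ p) (true ∷ q)  =
  subst (suc ∣ p ∪ q ∣ ≤_) (sym (+-suc ∣ p ∣ ∣ q ∣)) (s≤s (∣p∪q∣≤∣p∣+∣q∣ p q))
∣p∪q∣≤∣p∣+∣q∣ (true ∷ p)  (false ∷ q) = s≤s (∣p∪q∣≤∣p∣+∣q∣ p q)
∣p∪q∣≤∣p∣+∣q∣ (true ∷ p)  (true ∷ q)  =
  s≤s (≤-trans (∣p∪q∣≤∣p∣+∣q∣ p q) (subst (∣ p ∣ + ∣ q ∣ ≤_) (sym (+-suc ∣ p ∣ ∣ q ∣)) (n≤1+n _)))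

at-most-two : ∀ {n} (S : Subset n) x y → (∀ i → i ∈ S → i ≡ x ⊎ i ≡ y) → ∣ S ∣ ≤ 2
at-most-two S x y h = begin
  ∣ S ∣                 ≤⟨ p⊆q⇒∣p∣≤∣q∣ (λ {i} → into i) ⟩
  ∣ ⁅ x ⁆ ∪ ⁅ y ⁆ ∣     ≤⟨ ∣p∪q∣≤∣p∣+∣q∣ ⁅ x ⁆ ⁅ y ⁆ ⟩
  ∣ ⁅ x ⁆ ∣ + ∣ ⁅ y ⁆ ∣ ≡⟨ cong₂ _+_ (∣⁅x⁆∣≡1 x) (∣⁅x⁆∣≡1 y) ⟩
  2                     ∎
  where
  open ≤-Reasoning
  into : ∀ i → i ∈ S → i ∈ ⁅ x ⁆ ∪ ⁅ y ⁆
  into i iS with h i iS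
  ... | inj₁ refl = x∈p∪q⁺ (inj₁ (x∈⁅x⁆ x))
  ... | inj₂ refl = x∈p∪q⁺ (inj₂ (x∈⁅x⁆ y))

3≰2 : ¬ (3 ≤ 2)
3≰2 (s≤s (s≤s ()))

∉-minus-self : ∀ {n} (p : Subset n) y → y ∉ p - y
∉-minus-self (x ∷ p) F.zero ()
∉-minus-self (x ∷ p) (F.suc y) (there h) = ∉-minus-self p y h

∈-minus⇒≢ : ∀ {n} (p : Subset n) y i → i ∈ p - y → i ≢ y
∈-minus⇒≢ p y i h refl = ∉-minus-self p y h

∈-minus⇒∈ : ∀ {n} (p : Subset n) y {i} → i ∈ p - y → i ∈ p
∈-minus⇒∈ p y h = SP.p─q⊆p p ⁅ y ⁆ h

-- The posets 𝒞(X) on ℤ/n and good matchings on them.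

module Covering (m : ℕ) where
  open Cyclic m

  Covered : Family n → Fin n → Set
  Covered σ i = ∃[ v ] (v ∈F σ × i ∈ v)

  abstract
    Covered? : ∀ σ i → Dec (Covered σ i)
    Covered? σ i = anySubset? (λ v → (v ∈F? σ) ×-dec (i ∈? v))

  CycStable : Subset n → Set
  CycStable v = ¬ (Σ (Fin n) λ t → t ∈ v × sucMod t ∈ v)

  StableTriple : Subset n → Set
  StableTriple v = ∣ v ∣ ≡ 3 × CycStable v

  _⊆ₛ_ : Subset n → Subset n → Set
  v ⊆ₛ X = ∀ i → i ∈ v → i ∈ X

  CoversAll : Subset n → Family n → Set
  CoversAll Y ρ = ∀ i → i ∈ Y → Covered ρ i

  CoversAll-mono : ∀ {Y ρ ρ′} → ρ ⊆F ρ′ → CoversAll Y ρ → CoversAll Y ρ′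
  CoversAll-mono s g i iY = let (v , vρ , iv) = g i iY in v , s v vρ , iv

  𝒞 : Subset n → Family n → Set
  𝒞 X σ = (∀ v → v ∈F σ → StableTriple v × v ⊆ₛ X) × (∃[ v ] v ∈F σ) × CoversAll X σ

  𝒞-insert : ∀ {X σ t} → 𝒞 X σ → StableTriple t → t ⊆ₛ X → 𝒞 X (insert t σ)
  𝒞-insert {X} {σ} {t} (mem , (v , vσ) , cov) tV tX =
    mem′ , (v , insert-⊆ t σ v vσ) , CoversAll-mono (insert-⊆ t σ) cov
    where
    mem′ : ∀ w → w ∈F insert t σ → StableTriple w × w ⊆ₛ X
    mem′ w h with insert⁻ t σ w h
    ... | inj₁ refl = tV , tX
    ... | inj₂ wσ   = mem w wσ

  𝒞⇒3≤∣X∣ : ∀ {X σ} → 𝒞 X σ → 3 ≤ ∣ X ∣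
  𝒞⇒3≤∣X∣ {X} (mem , (v , vσ) , _) =
    subst (_≤ ∣ X ∣) (proj₁ (proj₁ (mem v vσ))) (p⊆q⇒∣p∣≤∣q∣ (λ {i} → proj₂ (mem v vσ) i))

  Pivot : Subset n → Fin n → Set
  Pivot X a = a ∈ X × sucMod a ∈ X × (∀ x → x ∈ X → sucMod x ≢ a)

  abstract
    pivot? : ∀ X → Dec (∃ (Pivot X))
    pivot? X = any? (λ a → (a ∈? X) ×-dec ((sucMod a ∈? X) ×-dec
                 all? (λ x → (x ∈? X) →-dec ¬? (sucMod x F.≟ a))))

  record GoodMatching (X : Subset n) (R : Family n → Family n → Set) : Set₁ where
    field
      extends    : ∀ {σ τ} → R σ τ → 𝒞 X σ × 𝒞 X τ × Σ (Subset n) λ t → ¬ (t ∈F σ) × τ ≡ insert t σ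
      functional : ∀ {σ τ τ′} → R σ τ → R σ τ′ → τ ≡ τ′
      injective  : ∀ {σ σ′ τ} → R σ τ → R σ′ τ → σ ≡ σ′
      one-role   : ∀ {σ τ υ} → R υ σ → R σ τ → ⊥
      acyclic    : IsAcyclic (𝒞 X) R

  emptyGood : ∀ X → GoodMatching X (λ _ _ → ⊥)
  emptyGood X = record { extends = λ () ; functional = λ () ; injective = λ () ; one-role = λ ()
                       ; acyclic = λ _ _ _ _ matched _ → matched F.zero }

  module PivotStep (X : Subset n) (a₁ : Fin n) (pivot : Pivot X a₁) where
    a₂ : Fin n
    a₂ = sucMod a₁

    X′ : Subset n
    X′ = X - a₁

    a₁∈X : a₁ ∈ X
    a₁∈X = proj₁ pivot

    a₂∈X : a₂ ∈ X
    a₂∈X = proj₁ (proj₂ pivot)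

    no-pred : ∀ x → x ∈ X → sucMod x ≢ a₁
    no-pred = proj₂ (proj₂ pivot)

    a₁≢a₂ : a₁ ≢ a₂
    a₁≢a₂ e = sucMod-≢ a₁ (sym e)

    a₁∈? : ∀ v → Dec (a₁ ∈ v)
    a₁∈? v = a₁ ∈? v

    a₁∉? : ∀ v → Dec (a₁ ∉ v)
    a₁∉? v = ¬? (a₁ ∈? v)

    thru : Family n → Family n
    thru = filterF (a₁ ∈_) a₁∈?

    rest : Family n → Family n
    rest = filterF (a₁ ∉_) a₁∉?

    thru⁺ : ∀ {σ} v → a₁ ∈ v → v ∈F σ → v ∈F thru σ
    thru⁺ {σ} = filterF⁺ (a₁ ∈_) a₁∈? σ
    thru⁻ : ∀ {σ} v → v ∈F thru σ → a₁ ∈ v × v ∈F σ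
    thru⁻ {σ} = filterF⁻ (a₁ ∈_) a₁∈? σ
    rest⁺ : ∀ {σ} v → a₁ ∉ v → v ∈F σ → v ∈F rest σ
    rest⁺ {σ} = filterF⁺ (a₁ ∉_) a₁∉? σ
    rest⁻ : ∀ {σ} v → v ∈F rest σ → a₁ ∉ v × v ∈F σ
    rest⁻ {σ} = filterF⁻ (a₁ ∉_) a₁∉? σ

    thru-mono : ∀ {σ τ} → σ ⊆F τ → thru σ ⊆F thru τ
    thru-mono s v h = let (p , q) = thru⁻ v h in thru⁺ v p (s v q)
    rest-mono : ∀ {σ τ} → σ ⊆F τ → rest σ ⊆F rest τ
    rest-mono s v h = let (p , q) = rest⁻ v h in rest⁺ v p (s v q)

    split-⊆ : ∀ {σ τ} → thru σ ⊆F thru τ → rest σ ⊆F rest τ → σ ⊆F τ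
    split-⊆ h₁ h₂ v vσ with a₁ ∈? v
    ... | yes p = proj₂ (thru⁻ v (h₁ v (thru⁺ v p vσ)))
    ... | no p  = proj₂ (rest⁻ v (h₂ v (rest⁺ v p vσ)))

    split-ext : ∀ {σ τ} → thru σ ≡ thru τ → rest σ ≡ rest τ → σ ≡ τ
    split-ext e₁ e₂ = family-ext (split-⊆ (⊆F-refl e₁) (⊆F-refl e₂))
                                 (split-⊆ (⊆F-refl (sym e₁)) (⊆F-refl (sym e₂)))

    rest-insert-thru : ∀ {t σ} → a₁ ∈ t → rest (insert t σ) ≡ rest σ
    rest-insert-thru {t} {σ} a₁t = family-ext down (rest-mono (insert-⊆ t σ))
      where
      down : rest (insert t σ) ⊆F rest σ
      down v h with rest⁻ v h
      ... | (a₁∉v , vi) with insert⁻ t σ v vi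
      ... | inj₁ refl = ⊥-elim (a₁∉v a₁t)
      ... | inj₂ vσ   = rest⁺ v a₁∉v vσ

    rest-remove-thru : ∀ {t σ} → a₁ ∈ t → rest (remove t σ) ≡ rest σ
    rest-remove-thru {t} {σ} a₁t = family-ext (rest-mono (λ v h → proj₂ (remove⁻ t σ v h))) up
      where
      up : rest σ ⊆F rest (remove t σ)
      up v h = let (a₁∉v , vσ) = rest⁻ v h in rest⁺ v a₁∉v (remove⁺ t σ v (λ { refl → a₁∉v a₁t }) vσ)

    thru-insert-avoid : ∀ {t σ} → a₁ ∉ t → thru (insert t σ) ≡ thru σ
    thru-insert-avoid {t} {σ} a₁∉t = family-ext down (thru-mono (insert-⊆ t σ))
      where
      down : thru (insert t σ) ⊆F thru σ
      down v h with thru⁻ v h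
      ... | (a₁v , vi) with insert⁻ t σ v vi
      ... | inj₁ refl = ⊥-elim (a₁∉t a₁v)
      ... | inj₂ vσ   = thru⁺ v a₁v vσ

    rest-insert-avoid : ∀ {t σ} → a₁ ∉ t → rest (insert t σ) ≡ insert t (rest σ)
    rest-insert-avoid {t} {σ} a₁∉t = family-ext down up
      where
      down : rest (insert t σ) ⊆F insert t (rest σ)
      down v h with rest⁻ v h
      ... | (a₁∉v , vi) with insert⁻ t σ v vi
      ... | inj₁ refl = insert-∋ t (rest σ)
      ... | inj₂ vσ   = insert-⊆ t (rest σ) v (rest⁺ v a₁∉v vσ)
      up : insert t (rest σ) ⊆F rest (insert t σ)
      up v h with insert⁻ t (rest σ) v h
      ... | inj₁ refl = rest⁺ v a₁∉t (insert-∋ t σ)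
      ... | inj₂ vρ   = rest-mono (insert-⊆ t σ) v vρ

    module Glue {α ρ : Family n} (α-thru : ∀ v → v ∈F α → a₁ ∈ v) (ρ-avoid : ∀ v → v ∈F ρ → a₁ ∉ v) where
      thru-glue : thru (unionF α ρ) ≡ α
      thru-glue = family-ext down (λ v h → thru⁺ v (α-thru v h) (unionF⁺ α ρ v (inj₁ h)))
        where
        down : thru (unionF α ρ) ⊆F α
        down v h with thru⁻ v h
        ... | (a₁v , vu) with unionF⁻ α ρ v vu
        ... | inj₁ vα = vα
        ... | inj₂ vρ = ⊥-elim (ρ-avoid v vρ a₁v)

      rest-glue : rest (unionF α ρ) ≡ ρ
      rest-glue = family-ext down (λ v h → rest⁺ v (ρ-avoid v h) (unionF⁺ α ρ v (inj₂ h)))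
        where
        down : rest (unionF α ρ) ⊆F ρ
        down v h with rest⁻ v h
        ... | (a₁∉v , vu) with unionF⁻ α ρ v vu
        ... | inj₁ vα = ⊥-elim (a₁∉v (α-thru v vα))
        ... | inj₂ vρ = vρ

    thru-∋ : ∀ σ v → v ∈F thru σ → a₁ ∈ v
    thru-∋ σ v h = proj₁ (thru⁻ v h)

    𝒞X′-avoids : ∀ {ρ} → 𝒞 X′ ρ → ∀ v → v ∈F ρ → a₁ ∉ v
    𝒞X′-avoids (mem , _) v h a₁v = ∉-minus-self X a₁ (proj₂ (mem v h) a₁ a₁v)

    𝒞-glue : ∀ {σ ρ} → 𝒞 X σ → 𝒞 X′ ρ → 𝒞 X (unionF (thru σ) ρ)
    𝒞-glue {σ} {ρ} (memσ , _ , covσ) (memρ , (w , wρ) , covρ) =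
      mem , (w , unionF⁺ _ _ w (inj₂ wρ)) , cov
      where
      mem : ∀ v → v ∈F unionF (thru σ) ρ → StableTriple v × v ⊆ₛ X
      mem v h with unionF⁻ _ _ v h
      ... | inj₁ x = memσ v (proj₂ (thru⁻ v x))
      ... | inj₂ x = proj₁ (memρ v x) , (λ i iv → ∈-minus⇒∈ X a₁ (proj₂ (memρ v x) i iv))
      cov : CoversAll X (unionF (thru σ) ρ)
      cov i iX with i F.≟ a₁
      ... | yes refl = let (v , vσ , iv) = covσ i iX in v , unionF⁺ _ _ v (inj₁ (thru⁺ v iv vσ)) , iv
      ... | no ne    = let (v , vρ , iv) = covρ i (SP.x∈p∧x≢y⇒x∈p-y iX ne) in v , unionF⁺ _ _ v (inj₂ vρ) , iv

    rest-inside : ∀ {σ} → 𝒞 X σ → ∀ v → v ∈F rest σ → StableTriple v × v ⊆ₛ X′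
    rest-inside (mem , _) v h =
      let (a₁∉v , vσ) = rest⁻ v h in
      proj₁ (mem v vσ) , λ i iv → SP.x∈p∧x≢y⇒x∈p-y (proj₂ (mem v vσ) i iv) (λ e → a₁∉v (subst (_∈ v) e iv))

    -- Whether the remainder covers X′ decides which kind of pair σ belongs to.
    RestCovers : Family n → Set
    RestCovers = CoversAll X′

    RestCovers? : ∀ ρ → Dec (RestCovers ρ)
    RestCovers? ρ = all? (λ i → (i ∈? X′) →-dec Covered? ρ i)

    -- slide v = v ∖ {a₂} ∪ {a₁}.  Since a₁ has no predecessor in X, sliding a stable triple
    -- of X containing a₂ but not a₁ gives a stable triple of X through a₁.
    slide : Subset n → Subset n
    slide v = (v [ a₂ ]≔ false) [ a₁ ]≔ true

    slide-∋ : ∀ v → a₁ ∈ slide v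
    slide-∋ v = lookup⇒∈ (VP.lookup∘update a₁ (v [ a₂ ]≔ false) true)

    slide⁻ : ∀ v i → i ∈ slide v → i ≡ a₁ ⊎ (i ∈ v × i ≢ a₂)
    slide⁻ v i h with i F.≟ a₁
    ... | yes e = inj₁ e
    ... | no ne with i F.≟ a₂
    ... | yes refl = ⊥-elim (false≢true (begin
            false                               ≡⟨ sym (VP.lookup∘update a₂ v false) ⟩
            lookup (v [ a₂ ]≔ false) a₂         ≡⟨ sym (VP.lookup∘update′ ne (v [ a₂ ]≔ false) true) ⟩
            lookup (slide v) a₂                 ≡⟨ ∈⇒lookup h ⟩
            true                                ∎))
      where
      open ≡-Reasoning
      false≢true : false ≢ true
      false≢true ()
    ... | no ne₂ = inj₂ (lookup⇒∈ (begin
            lookup v i                          ≡⟨ sym (VP.lookup∘update′ ne₂ v false) ⟩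
            lookup (v [ a₂ ]≔ false) i          ≡⟨ sym (VP.lookup∘update′ ne (v [ a₂ ]≔ false) true) ⟩
            lookup (slide v) i                  ≡⟨ ∈⇒lookup h ⟩
            true                                ∎) , ne₂)
      where open ≡-Reasoning

    ∣slide∣ : ∀ v → a₂ ∈ v → a₁ ∉ v → ∣ slide v ∣ ≡ ∣ v ∣
    ∣slide∣ v a₂v a₁∉v = trans (∣set-true∣ (v [ a₂ ]≔ false) a₁ a₁-absent) (∣set-false∣ v a₂ (∈⇒lookup a₂v))
      where
      a₁-absent : lookup (v [ a₂ ]≔ false) a₁ ≡ false
      a₁-absent with lookup v a₁ in eq
      ... | false = trans (VP.lookup∘update′ a₁≢a₂ v false) eq
      ... | true  = ⊥-elim (a₁∉v (lookup⇒∈ eq))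

    slide-stable : ∀ v → CycStable v → v ⊆ₛ X → CycStable (slide v)
    slide-stable v st vX (i , i∈ , si∈) with slide⁻ v i i∈
    ... | inj₁ refl with slide⁻ v a₂ si∈
    ...   | inj₁ e        = a₁≢a₂ (sym e)
    ...   | inj₂ (_ , ne) = ne refl
    slide-stable v st vX (i , i∈ , si∈) | inj₂ (iv , _) with slide⁻ v (sucMod i) si∈
    ...   | inj₁ e         = no-pred i (vX i iv) e
    ...   | inj₂ (siv , _) = st (i , iv , siv)

    slide-⊆ : ∀ v → v ⊆ₛ X → slide v ⊆ₛ X
    slide-⊆ v vX i h with slide⁻ v i h
    ... | inj₁ refl     = a₁∈X
    ... | inj₂ (iv , _) = vX i iv

    MeetsA₂ : Family n → Set
    MeetsA₂ ρ = ∃ λ v → v ∈F ρ × a₂ ∈ v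

    -- The toggle vertex of a remainder ρ: the slide of a (fixed) vertex of ρ through a₂.
    -- It depends on ρ only, which is what makes toggling an involution.
    abstract
      toggle′ : ∀ {ρ} → Dec (MeetsA₂ ρ) → Subset n
      toggle′ (yes (v , _)) = slide v
      toggle′ (no _)        = replicate _ false

      toggle : Family n → Subset n
      toggle ρ = toggle′ (anySubset? (λ v → (v ∈F? ρ) ×-dec (a₂ ∈? v)))

      toggle-spec : ∀ ρ → MeetsA₂ ρ → Σ (Subset n) λ v → v ∈F ρ × a₂ ∈ v × toggle ρ ≡ slide v
      toggle-spec ρ ex with anySubset? (λ v → (v ∈F? ρ) ×-dec (a₂ ∈? v))
      ... | yes (v , vρ , a₂v) = v , vρ , a₂v , refl
      ... | no ¬ex             = ⊥-elim (¬ex ex)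

    -- a₂ is covered by a vertex of σ, which cannot contain a₁ by stability.
    rest-meets-a₂ : ∀ {σ} → 𝒞 X σ → MeetsA₂ (rest σ)
    rest-meets-a₂ (mem , _ , cov) with cov a₂ a₂∈X
    ... | (v , vσ , a₂v) = v , rest⁺ v (λ a₁v → proj₂ (proj₁ (mem v vσ)) (a₁ , a₁v , a₂v)) vσ , a₂v

    record ToggleFacts (σ : Family n) (t : Subset n) : Set where
      field
        triple  : StableTriple t
        inside  : t ⊆ₛ X
        through : a₁ ∈ t
        covered : ∀ i → i ∈ t → i ≢ a₁ → Covered (rest σ) i

    toggleFacts : ∀ {σ} → 𝒞 X σ → ToggleFacts σ (toggle (rest σ))
    toggleFacts {σ} pσ@(mem , _ , _) with toggle-spec (rest σ) (rest-meets-a₂ pσ)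
    ... | (v , vρ , a₂v , eq) = subst (ToggleFacts σ) (sym eq) (record
      { triple  = trans (∣slide∣ v a₂v a₁∉v) (proj₁ (proj₁ mv)) , slide-stable v (proj₂ (proj₁ mv)) (proj₂ mv)
      ; inside  = slide-⊆ v (proj₂ mv)
      ; through = slide-∋ v
      ; covered = λ i it ne → case i ne (slide⁻ v i it) })
      where
      a₁∉v : a₁ ∉ v
      a₁∉v = proj₁ (rest⁻ v vρ)
      mv : StableTriple v × v ⊆ₛ X
      mv = mem v (proj₂ (rest⁻ v vρ))
      case : ∀ i → i ≢ a₁ → i ≡ a₁ ⊎ (i ∈ v × i ≢ a₂) → Covered (rest σ) i
      case i ne (inj₁ e)        = ⊥-elim (ne e)
      case i ne (inj₂ (iv , _)) = v , vρ , iv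

    Toggle : Family n → Family n → Set
    Toggle σ τ = 𝒞 X σ × ¬ RestCovers (rest σ) × ¬ (toggle (rest σ) ∈F σ) × τ ≡ insert (toggle (rest σ)) σ

    Lift : (Family n → Family n → Set) → Family n → Family n → Set
    Lift R σ τ = 𝒞 X σ × 𝒞 X τ × RestCovers (rest σ) × thru σ ≡ thru τ × R (rest σ) (rest τ)

    Extended : (Family n → Family n → Set) → Family n → Family n → Set
    Extended R σ τ = Toggle σ τ ⊎ Lift R σ τ

    -- Toggling changes only the part through a₁, so the remainder is unchanged.
    Toggle-rest : ∀ {σ τ} → Toggle σ τ → rest τ ≡ rest σ
    Toggle-rest (pσ , _ , _ , refl) = rest-insert-thru (ToggleFacts.through (toggleFacts pσ))

    module Extend (R : Family n → Family n → Set) (good : GoodMatching X′ R) where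
      private module R = GoodMatching good

      M : Family n → Family n → Set
      M = Extended R

      Lift-restCovers : ∀ {σ τ} → Lift R σ τ → RestCovers (rest τ)
      Lift-restCovers (_ , _ , _ , _ , r) = proj₂ (proj₂ (proj₁ (proj₂ (R.extends r))))

      -- A lifted pair adds the vertex added by R, which avoids a₁.
      Lift-extends : ∀ {σ τ} → Lift R σ τ → Σ (Subset n) λ t → ¬ (t ∈F σ) × τ ≡ insert t σ
      Lift-extends {σ} {τ} (_ , _ , _ , eq-thru , r) with R.extends r
      ... | (_ , pτ′ , t , t∉ , eq) = t , t∉σ , eqτ
        where
        a₁∉t : a₁ ∉ t
        a₁∉t = 𝒞X′-avoids pτ′ t (subst (t ∈F_) (sym eq) (insert-∋ t (rest σ)))
        t∉σ : ¬ (t ∈F σ)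
        t∉σ tσ = t∉ (rest⁺ t a₁∉t tσ)
        eqτ : τ ≡ insert t σ
        eqτ = split-ext (trans (sym eq-thru) (sym (thru-insert-avoid a₁∉t)))
                        (trans eq (sym (rest-insert-avoid a₁∉t)))

      extends : ∀ {σ τ} → M σ τ → 𝒞 X σ × 𝒞 X τ × Σ (Subset n) λ t → ¬ (t ∈F σ) × τ ≡ insert t σ
      extends {σ} (inj₁ (pσ , _ , t∉ , eq)) =
        pσ , subst (𝒞 X) (sym eq) (𝒞-insert pσ (ToggleFacts.triple f) (ToggleFacts.inside f)) , _ , t∉ , eq
        where
        f : ToggleFacts σ (toggle (rest σ))
        f = toggleFacts pσ
      extends (inj₂ l@(pσ , pτ , _)) = pσ , pτ , Lift-extends l

      -- Each bottom has one partner: the kind of pair is fixed by the bottom's remainder.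
      functional : ∀ {σ τ τ′} → M σ τ → M σ τ′ → τ ≡ τ′
      functional (inj₁ (_ , _ , _ , e)) (inj₁ (_ , _ , _ , e′)) = trans e (sym e′)
      functional (inj₁ (_ , ¬c , _)) (inj₂ (_ , _ , c , _))     = ⊥-elim (¬c c)
      functional (inj₂ (_ , _ , c , _)) (inj₁ (_ , ¬c , _))     = ⊥-elim (¬c c)
      functional (inj₂ (_ , _ , _ , e , r)) (inj₂ (_ , _ , _ , e′ , r′)) =
        split-ext (trans (sym e) e′) (R.functional r r′)

      -- Two toggle pairs with the same top have the same remainder, hence the same toggle vertex.
      Toggle-injective : ∀ {σ σ′ τ} → Toggle σ τ → Toggle σ′ τ → σ ≡ σ′
      Toggle-injective {σ} {σ′} x@(_ , _ , t∉ , e) y@(_ , _ , t∉′ , e′) =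
        insert-cancel t σ σ′ t∉ (subst (λ z → ¬ (z ∈F σ′)) (sym same-t) t∉′)
                      (trans (sym e) (trans e′ (cong (λ z → insert z σ′) (sym same-t))))
        where
        t : Subset n
        t = toggle (rest σ)
        same-t : toggle (rest σ) ≡ toggle (rest σ′)
        same-t = cong toggle (trans (sym (Toggle-rest x)) (Toggle-rest y))

      -- A toggle top has an uncovering remainder, a lifted top a covering one.
      Toggle-Lift-disjoint : ∀ {σ σ′ τ} → Toggle σ τ → Lift R σ′ τ → ⊥
      Toggle-Lift-disjoint x@(_ , ¬c , _) y = ¬c (subst RestCovers (Toggle-rest x) (Lift-restCovers y))

      injective : ∀ {σ σ′ τ} → M σ τ → M σ′ τ → σ ≡ σ′
      injective (inj₁ x) (inj₁ y) = Toggle-injective x y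
      injective (inj₁ x) (inj₂ y) = ⊥-elim (Toggle-Lift-disjoint x y)
      injective (inj₂ y) (inj₁ x) = ⊥-elim (Toggle-Lift-disjoint x y)
      injective (inj₂ (_ , _ , _ , e , r)) (inj₂ (_ , _ , _ , e′ , r′)) =
        split-ext (trans e (sym e′)) (R.injective r r′)

      -- No family is both a top and a bottom: a toggle bottom lacks the toggle vertex that a
      -- toggle top contains, and lifted pairs inherit the property from R.
      one-role : ∀ {σ τ υ} → M υ σ → M σ τ → ⊥
      one-role {σ} {υ = υ} (inj₁ x@(_ , _ , _ , e)) (inj₁ (_ , _ , t∉ , _)) =
        t∉ (subst (_∈F σ) (cong toggle (sym (Toggle-rest x)))
                  (subst (toggle (rest υ) ∈F_) (sym e) (insert-∋ (toggle (rest υ)) υ)))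
      one-role (inj₁ x@(_ , ¬c , _)) (inj₂ (_ , _ , c , _)) = ¬c (subst RestCovers (Toggle-rest x) c)
      one-role (inj₂ y) (inj₁ (_ , ¬c , _))                 = ¬c (Lift-restCovers y)
      one-role (inj₂ (_ , _ , _ , _ , r)) (inj₂ (_ , _ , _ , _ , r′)) = R.one-role r r′

      -- An alternating cycle of M either consists of toggle pairs only, which is impossible
      -- because the remainder stays constant, or of lifted pairs only, whose remainders form
      -- an alternating cycle of R.
      module AlternatingCycle (m₀ : ℕ) (σ τ : Fin (suc (suc m₀)) → Family n)
                              (distinct : ∀ i j → σ i ≡ σ j → i ≡ j)
                              (matched : ∀ i → M (σ i) (τ i))
                              (covered : ∀ i → Covers (𝒞 X) (σ (sucMod i)) (τ i)) where
        private module C₀ = Cyclic m₀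

        next-⊆ : ∀ i → σ (sucMod i) ⊆F τ i
        next-⊆ i = proj₁ (proj₁ (proj₂ (proj₂ (covered i))))

        next-≢ : ∀ i → σ (sucMod i) ≢ τ i
        next-≢ i = proj₂ (proj₁ (proj₂ (proj₂ (covered i))))

        nothing-between : ∀ i υ → 𝒞 X υ → σ (sucMod i) ⊂F υ → υ ⊂F τ i → ⊥
        nothing-between i = proj₂ (proj₂ (proj₂ (covered i)))

        Covering-rest : Fin (suc (suc m₀)) → Set
        Covering-rest i = RestCovers (rest (σ i))

        as-toggle : ∀ i → ¬ Covering-rest i → Toggle (σ i) (τ i)
        as-toggle i ¬c with matched i
        ... | inj₁ x = x
        ... | inj₂ (_ , _ , c , _) = ⊥-elim (¬c c)

        uncovering-propagates : ∀ i → ¬ Covering-rest i → ¬ Covering-rest (sucMod i)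
        uncovering-propagates i ¬c c′ =
          ¬c (CoversAll-mono (⊆F-refl (Toggle-rest (as-toggle i ¬c)))
                             (CoversAll-mono (rest-mono (next-⊆ i)) c′))

        toggle-cycle : ¬ Covering-rest F.zero → ⊥
        toggle-cycle ¬c₀ = nothing-between F.zero (σ F.zero) p₀
          (σ₁⊆σ₀ , (λ e → C₀.sucMod-≢ F.zero (distinct _ _ e)))
          ((λ v h → subst (v ∈F_) (sym e₀) (insert-⊆ t₀ (σ F.zero) v h)) ,
           (λ e → insert-≢ t₀ (σ F.zero) t₀∉σ₀ (trans e e₀)))
          where
          i₁ : Fin (suc (suc m₀))
          i₁ = sucMod F.zero
          toggles : ∀ i → Toggle (σ i) (τ i)
          toggles i = as-toggle i (C₀.around-the-cycle _ uncovering-propagates F.zero i ¬c₀)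
          rest-constant : rest (σ i₁) ≡ rest (σ F.zero)
          rest-constant = C₀.descending-families-constant (λ i → rest (σ i))
            (λ i → ⊆F-trans (rest-mono (next-⊆ i)) (⊆F-refl (Toggle-rest (toggles i)))) i₁ F.zero
          p₀ : 𝒞 X (σ F.zero)
          p₀ = proj₁ (toggles F.zero)
          t₀ : Subset n
          t₀ = toggle (rest (σ F.zero))
          t₀∉σ₀ : ¬ (t₀ ∈F σ F.zero)
          t₀∉σ₀ = proj₁ (proj₂ (proj₂ (toggles F.zero)))
          e₀ : τ F.zero ≡ insert t₀ (σ F.zero)
          e₀ = proj₂ (proj₂ (proj₂ (toggles F.zero)))
          t₀∉σ₁ : ¬ (t₀ ∈F σ i₁)
          t₀∉σ₁ = subst (λ z → ¬ (z ∈F σ i₁)) (cong toggle rest-constant) (proj₁ (proj₂ (proj₂ (toggles i₁))))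
          σ₁⊆σ₀ : σ i₁ ⊆F σ F.zero
          σ₁⊆σ₀ v h with insert⁻ t₀ (σ F.zero) v (subst (v ∈F_) e₀ (next-⊆ F.zero v h))
          ... | inj₁ refl = ⊥-elim (t₀∉σ₁ h)
          ... | inj₂ x    = x

        module AllLifted (lifted : ∀ i → Lift R (σ i) (τ i)) where
          thru-matched : ∀ i → thru (σ i) ≡ thru (τ i)
          thru-matched i = proj₁ (proj₂ (proj₂ (proj₂ (lifted i))))

          rest-matched : ∀ i → R (rest (σ i)) (rest (τ i))
          rest-matched i = proj₂ (proj₂ (proj₂ (proj₂ (lifted i))))

          thru-constant : ∀ i j → thru (σ i) ≡ thru (σ j)
          thru-constant = C₀.descending-families-constant (λ i → thru (σ i))
            (λ i → ⊆F-trans (thru-mono (next-⊆ i)) (⊆F-refl (sym (thru-matched i))))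

          rest-distinct : ∀ i j → rest (σ i) ≡ rest (σ j) → i ≡ j
          rest-distinct i j e = distinct i j (split-ext (thru-constant i j) e)

          -- A family strictly between the remainders lifts, by gluing, to one strictly
          -- between σ (i+1) and τ i.
          rest-covered : ∀ i → Covers (𝒞 X′) (rest (σ (sucMod i))) (rest (τ i))
          rest-covered i =
            proj₁ (R.extends (rest-matched (sucMod i))) , proj₁ (proj₂ (R.extends (rest-matched i))) ,
            (rest-mono (next-⊆ i) ,
             (λ e → next-≢ i (split-ext (trans (thru-constant (sucMod i) i) (thru-matched i)) e))) ,
            between
            where
            between : ∀ ρ → 𝒞 X′ ρ → rest (σ (sucMod i)) ⊂F ρ → ρ ⊂F rest (τ i) → ⊥
            between ρ pρ (s₁ , n₁) (s₂ , n₂) = nothing-between i υ (𝒞-glue (proj₁ (lifted i)) pρ)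
              (split-⊆ (⊆F-refl (trans (thru-constant (sucMod i) i) (sym thru-υ))) (⊆F-trans s₁ (⊆F-refl (sym rest-υ))) ,
               (λ e → n₁ (trans (cong rest e) rest-υ)))
              (split-⊆ (⊆F-refl (trans thru-υ (thru-matched i))) (⊆F-trans (⊆F-refl rest-υ) s₂) ,
               (λ e → n₂ (trans (sym rest-υ) (cong rest e))))
              where
              υ : Family n
              υ = unionF (thru (σ i)) ρ
              open Glue (thru-∋ (σ i)) (𝒞X′-avoids pρ)
              thru-υ : thru υ ≡ thru (σ i)
              thru-υ = thru-glue
              rest-υ : rest υ ≡ ρ
              rest-υ = rest-glue

          absurd : ⊥
          absurd = R.acyclic m₀ (λ i → rest (σ i)) (λ i → rest (τ i)) rest-distinct rest-matched rest-covered

        lifted-cycle : Covering-rest F.zero → ⊥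
        lifted-cycle c₀ = AllLifted.absurd as-lift
          where
          as-lift : ∀ i → Lift R (σ i) (τ i)
          as-lift i with matched i
          ... | inj₂ y = y
          ... | inj₁ (_ , ¬c , _) =
            ⊥-elim (C₀.around-the-cycle (λ j → ¬ Covering-rest j) uncovering-propagates i F.zero ¬c c₀)

        absurd : ⊥
        absurd with RestCovers? (rest (σ F.zero))
        ... | yes c₀ = lifted-cycle c₀
        ... | no ¬c₀ = toggle-cycle ¬c₀

      acyclic : IsAcyclic (𝒞 X) M
      acyclic m₀ σ τ distinct matched covered = AlternatingCycle.absurd m₀ σ τ distinct matched covered

      extendGood : GoodMatching X M
      extendGood = record { extends = extends ; functional = functional ; injective = injective
                          ; one-role = one-role ; acyclic = acyclic }

      module Partner (R-perfect : ∀ {ρ} → 𝒞 X′ ρ → ∃ λ ρ′ → R ρ ρ′ ⊎ R ρ′ ρ) {σ : Family n} (pσ : 𝒞 X σ) where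
        private
          cov : CoversAll X σ
          cov = proj₂ (proj₂ pσ)
          facts : ToggleFacts σ (toggle (rest σ))
          facts = toggleFacts pσ
          t : Subset n
          t = toggle (rest σ)

        rest-𝒞 : RestCovers (rest σ) → 𝒞 X′ (rest σ)
        rest-𝒞 c = rest-inside pσ , (let (v , vρ , _) = rest-meets-a₂ pσ in v , vρ) , c

        regraft : ∀ ρ → 𝒞 X′ ρ → 𝒞 X (unionF (thru σ) ρ) × thru (unionF (thru σ) ρ) ≡ thru σ × rest (unionF (thru σ) ρ) ≡ ρ
        regraft ρ pρ = 𝒞-glue pσ pρ , thru-glue , rest-glue
          where open Glue (thru-∋ σ) (𝒞X′-avoids pρ)

        lifted-partner : RestCovers (rest σ) → ∃ λ τ → M σ τ ⊎ M τ σ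
        lifted-partner c with R-perfect (rest-𝒞 c)
        ... | (ρ , inj₁ r) =
          let (pτ , thru-τ , rest-τ) = regraft ρ (proj₁ (proj₂ (R.extends r))) in
          unionF (thru σ) ρ , inj₁ (inj₂ (pσ , pτ , c , sym thru-τ , subst (R (rest σ)) (sym rest-τ) r))
        ... | (ρ , inj₂ r) =
          let pρ = proj₁ (R.extends r) ; (pτ , thru-τ , rest-τ) = regraft ρ pρ in
          unionF (thru σ) ρ , inj₂ (inj₂ (pτ , pσ , subst RestCovers (sym rest-τ) (proj₂ (proj₂ pρ)) , thru-τ ,
                                           subst (λ z → R z (rest σ)) (sym rest-τ) r))

        -- Some point of X′ is not covered by the remainder; it is covered by a vertex through
        -- a₁ different from t (whose other points are covered by the remainder).
        other-through-a₁ : ¬ RestCovers (rest σ) → Σ (Subset n) λ v → v ∈F remove t σ × a₁ ∈ v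
        other-through-a₁ ¬c with ¬∀⟶∃¬ n (λ i → i ∈ X′ → Covered (rest σ) i) (λ i → (i ∈? X′) →-dec Covered? (rest σ) i) ¬c
        ... | (i , ¬imp) with i ∈? X′
        ... | no i∉X′ = ⊥-elim (¬imp (λ p → ⊥-elim (i∉X′ p)))
        ... | yes i∈X′ with cov i (∈-minus⇒∈ X a₁ i∈X′)
        ...   | (v , vσ , iv) with a₁ ∈? v
        ...     | no a₁∉v = ⊥-elim (¬imp (λ _ → v , rest⁺ v a₁∉v vσ , iv))
        ...     | yes a₁v = v , remove⁺ t σ v v≢t vσ , a₁v
          where
          v≢t : v ≢ t
          v≢t refl = ¬imp (λ _ → ToggleFacts.covered facts i iv (∈-minus⇒≢ X a₁ i i∈X′))

        remove-toggle-𝒞 : ¬ RestCovers (rest σ) → 𝒞 X (remove t σ)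
        remove-toggle-𝒞 ¬c =
          (λ v h → proj₁ pσ v (proj₂ (remove⁻ t σ v h))) , (proj₁ other , proj₁ (proj₂ other)) , cov′
          where
          other : Σ (Subset n) λ v → v ∈F remove t σ × a₁ ∈ v
          other = other-through-a₁ ¬c
          cov′ : CoversAll X (remove t σ)
          cov′ j jX with cov j jX
          ... | (w , wσ , jw) with w ≟ₛ t
          ...   | no w≢t = w , remove⁺ t σ w w≢t wσ , jw
          ...   | yes refl with j F.≟ a₁
          ...     | yes refl = other
          ...     | no j≢a₁ with ToggleFacts.covered facts j jw j≢a₁
          ...       | (w′ , w′ρ , jw′) =
                        w′ , remove⁺ t σ w′ (λ e → proj₁ (rest⁻ w′ w′ρ) (subst (a₁ ∈_) (sym e) (ToggleFacts.through facts)))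
                                 (proj₂ (rest⁻ w′ w′ρ)) , jw′

        toggle-partner : ¬ RestCovers (rest σ) → Dec (t ∈F σ) → ∃ λ τ → M σ τ ⊎ M τ σ
        toggle-partner ¬c (no t∉σ) = insert t σ , inj₁ (inj₁ (pσ , ¬c , t∉σ , refl))
        toggle-partner ¬c (yes tσ) = remove t σ , inj₂ (inj₁ (remove-toggle-𝒞 ¬c , ¬c′ , t∉ , eq))
          where
          same-rest : rest (remove t σ) ≡ rest σ
          same-rest = rest-remove-thru (ToggleFacts.through facts)
          ¬c′ : ¬ RestCovers (rest (remove t σ))
          ¬c′ c = ¬c (subst RestCovers same-rest c)
          same-t : toggle (rest (remove t σ)) ≡ t
          same-t = cong toggle same-rest
          t∉ : ¬ (toggle (rest (remove t σ)) ∈F remove t σ)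
          t∉ h = proj₁ (remove⁻ t σ t (subst (_∈F remove t σ) same-t h)) refl
          eq : σ ≡ insert (toggle (rest (remove t σ))) (remove t σ)
          eq = trans (insert-remove t σ tσ) (cong (λ z → insert z (remove t σ)) (sym same-t))

        partner : ∃ λ τ → M σ τ ⊎ M τ σ
        partner with RestCovers? (rest σ)
        ... | yes c  = lifted-partner c
        ... | no ¬c = toggle-partner ¬c (t ∈F? σ)

  -- The matching on 𝒞(X): repeatedly extend at a pivot (fuel bounds the recursion depth).
  pivotMatching : ℕ → Subset n → Family n → Family n → Set
  pivotMatchingAt : ℕ → (X : Subset n) → Dec (∃ (Pivot X)) → Family n → Family n → Set
  pivotMatching zero    X = λ _ _ → ⊥
  pivotMatching (suc f) X = pivotMatchingAt f X (pivot? X)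
  pivotMatchingAt f X (no _)             = λ _ _ → ⊥
  pivotMatchingAt f X (yes (a₁ , pivot)) = PivotStep.Extended X a₁ pivot (pivotMatching f (X - a₁))

  pivotMatching-good : ∀ f X → GoodMatching X (pivotMatching f X)
  pivotMatchingAt-good : ∀ f X d → GoodMatching X (pivotMatchingAt f X d)
  pivotMatching-good zero    X = emptyGood X
  pivotMatching-good (suc f) X = pivotMatchingAt-good f X (pivot? X)
  pivotMatchingAt-good f X (no _)             = emptyGood X
  pivotMatchingAt-good f X (yes (a₁ , pivot)) =
    PivotStep.Extend.extendGood X a₁ pivot (pivotMatching f (X - a₁)) (pivotMatching-good f (X - a₁))

  RunStart : Subset n → Fin n → Set
  RunStart X i = i ∈ X × (∀ x → x ∈ X → sucMod x ≢ i)

  runStarts : Subset n → Subset n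
  runStarts X = subsetOf (λ i → (i ∈? X) ×-dec all? (λ x → (x ∈? X) →-dec ¬? (sucMod x F.≟ i)))

  runStarts⁺ : ∀ {X i} → RunStart X i → i ∈ runStarts X
  runStarts⁺ {X} = subsetOf⁺ (λ i → (i ∈? X) ×-dec all? (λ x → (x ∈? X) →-dec ¬? (sucMod x F.≟ i)))

  runStarts⁻ : ∀ {X i} → i ∈ runStarts X → RunStart X i
  runStarts⁻ {X} = subsetOf⁻ (λ i → (i ∈? X) ×-dec all? (λ x → (x ∈? X) →-dec ¬? (sucMod x F.≟ i)))

  -- The invariant guaranteeing perfection: at most two runs, and some point outside X.
  FewRuns : Subset n → Set
  FewRuns X = ∣ runStarts X ∣ ≤ 2 × ∃ λ c → c ∉ X

  predecessor-in : ∀ X y → ¬ (∀ x → x ∈ X → sucMod x ≢ y) → ∃ λ x → x ∈ X × sucMod x ≡ y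
  predecessor-in X y h with ¬∀⟶∃¬ n (λ x → x ∈ X → sucMod x ≢ y) (λ x → (x ∈? X) →-dec ¬? (sucMod x F.≟ y)) h
  ... | (x , ¬px) with x ∈? X | sucMod x F.≟ y
  ... | no x∉X | _      = ⊥-elim (¬px (λ x∈X → ⊥-elim (x∉X x∈X)))
  ... | yes x∈X | yes e = x , x∈X , e
  ... | yes _   | no ne = ⊥-elim (¬px (λ _ → ne))

  -- Walking backwards from a pair y, y+1 ∈ X, we reach a pivot before leaving X at c.
  walk-back : ∀ X c → c ∉ X → ∀ d y → sucMod^ d c ≡ y → y ∈ X → sucMod y ∈ X → ∃ (Pivot X)
  walk-back X c c∉X zero y refl y∈X _ = ⊥-elim (c∉X y∈X)
  walk-back X c c∉X (suc d) y e y∈X sy∈X with all? (λ x → (x ∈? X) →-dec ¬? (sucMod x F.≟ y))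
  ... | yes start = y , y∈X , sy∈X , start
  ... | no ¬start with predecessor-in X y ¬start
  ...   | (z , z∈X , sz) = walk-back X c c∉X d z (sucMod-injective (trans e (sym sz))) z∈X (subst (_∈ X) (sym sz) y∈X)

  -- Without a pivot every point of X starts a run, so X has at most two points.
  no-pivot⇒∣X∣≤2 : ∀ X → FewRuns X → ¬ ∃ (Pivot X) → ∣ X ∣ ≤ 2
  no-pivot⇒∣X∣≤2 X (few , c , c∉X) no-pivot = ≤-trans (p⊆q⇒∣p∣≤∣q∣ (λ {x} → all-start x)) few
    where
    all-start : ∀ x → x ∈ X → x ∈ runStarts X
    all-start x x∈X with all? (λ y → (y ∈? X) →-dec ¬? (sucMod y F.≟ x))
    ... | yes start = runStarts⁺ (x∈X , start)
    ... | no ¬start with predecessor-in X x ¬start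
    ...   | (y , y∈X , sy) with sucMod^-reaches c y
    ...     | (d , e) = ⊥-elim (no-pivot (walk-back X c c∉X d y e y∈X (subst (_∈ X) (sym sy) x∈X)))

  -- Removing a pivot a₁ trades the run start a₁ for (at most) the run start a₁ + 1.
  FewRuns-remove : ∀ X a₁ → Pivot X a₁ → FewRuns X → FewRuns (X - a₁)
  FewRuns-remove X a₁ pivot (few , c , c∉X) = count , c , (λ h → c∉X (∈-minus⇒∈ X a₁ h))
    where
    S : Subset n
    S = runStarts X
    a₁∈S : a₁ ∈ S
    a₁∈S = runStarts⁺ (proj₁ pivot , proj₂ (proj₂ pivot))
    new-starts : ∀ i → i ∈ runStarts (X - a₁) → i ∈ (S - a₁) ∪ ⁅ sucMod a₁ ⁆
    new-starts i h with runStarts⁻ {X - a₁} h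
    ... | (i∈X′ , start′) with i F.≟ sucMod a₁
    ...   | yes refl = x∈p∪q⁺ (inj₂ (x∈⁅x⁆ _))
    ...   | no ne    = x∈p∪q⁺ (inj₁ (SP.x∈p∧x≢y⇒x∈p-y (runStarts⁺ (∈-minus⇒∈ X a₁ i∈X′ , start))
                                                    (∈-minus⇒≢ X a₁ i i∈X′)))
      where
      start : ∀ x → x ∈ X → sucMod x ≢ i
      start x x∈X with x F.≟ a₁
      ... | yes refl = λ e → ne (sym e)
      ... | no x≢a₁  = start′ x (SP.x∈p∧x≢y⇒x∈p-y x∈X x≢a₁)
    count : ∣ runStarts (X - a₁) ∣ ≤ 2
    count = begin
      ∣ runStarts (X - a₁) ∣          ≤⟨ p⊆q⇒∣p∣≤∣q∣ (λ {i} → new-starts i) ⟩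
      ∣ (S - a₁) ∪ ⁅ sucMod a₁ ⁆ ∣    ≤⟨ ∣p∪q∣≤∣p∣+∣q∣ (S - a₁) ⁅ sucMod a₁ ⁆ ⟩
      ∣ S - a₁ ∣ + ∣ ⁅ sucMod a₁ ⁆ ∣  ≡⟨ cong (∣ S - a₁ ∣ +_) (∣⁅x⁆∣≡1 (sucMod a₁)) ⟩
      ∣ S - a₁ ∣ + 1                  ≡⟨ +-comm ∣ S - a₁ ∣ 1 ⟩
      suc ∣ S - a₁ ∣                  ≤⟨ SP.x∈p⇒∣p-x∣<∣p∣ a₁∈S ⟩
      ∣ S ∣                           ≤⟨ few ⟩
      2                               ∎
      where open ≤-Reasoning

  pivotMatching-perfect : ∀ f X {σ} → FewRuns X → ∣ X ∣ ≤ f + 2 → 𝒞 X σ →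
                          ∃ λ τ → pivotMatching f X σ τ ⊎ pivotMatching f X τ σ
  pivotMatchingAt-perfect : ∀ f X (d : Dec (∃ (Pivot X))) {σ} → FewRuns X → ∣ X ∣ ≤ suc f + 2 → 𝒞 X σ →
                            ∃ λ τ → pivotMatchingAt f X d σ τ ⊎ pivotMatchingAt f X d τ σ
  pivotMatching-perfect zero X few size pσ = ⊥-elim (3≰2 (≤-trans (𝒞⇒3≤∣X∣ pσ) size))
  pivotMatching-perfect (suc f) X few size pσ = pivotMatchingAt-perfect f X (pivot? X) few size pσ
  pivotMatchingAt-perfect f X (no no-pivot) few size pσ =
    ⊥-elim (3≰2 (≤-trans (𝒞⇒3≤∣X∣ pσ) (no-pivot⇒∣X∣≤2 X few no-pivot)))
  pivotMatchingAt-perfect f X (yes (a₁ , pivot)) few size pσ =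
    PivotStep.Extend.Partner.partner X a₁ pivot (pivotMatching f (X - a₁)) (pivotMatching-good f (X - a₁))
      (pivotMatching-perfect f (X - a₁) (FewRuns-remove X a₁ pivot few) size′) pσ
    where
    size′ : ∣ X - a₁ ∣ ≤ f + 2
    size′ = ≤-pred (≤-trans (SP.x∈p⇒∣p-x∣<∣p∣ (proj₁ pivot)) size)

-- The fibre of P through σ is the poset 𝒞(X) for X the set of points covered by σ.

module Fibres (k : ℕ) where
  open Cyclic (4 + k)
  open Covering (4 + k)

  support : Family n → Subset n
  support σ = subsetOf (Covered? σ)

  support⁺ : ∀ {σ i} → Covered σ i → i ∈ support σ
  support⁺ {σ} = subsetOf⁺ (Covered? σ)

  support⁻ : ∀ {σ i} → i ∈ support σ → Covered σ i
  support⁻ {σ} = subsetOf⁻ (Covered? σ)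

  support-𝒞 : ∀ {X σ} → 𝒞 X σ → support σ ≡ X
  support-𝒞 (mem , _ , cov) = SP.⊆-antisym
    (λ {i} h → let (v , vσ , iv) = support⁻ h in proj₂ (mem v vσ) i iv)
    (λ {i} h → support⁺ (cov i h))

  support-mono : ∀ {σ τ} → σ ⊆F τ → support σ ⊆ₛ support τ
  support-mono s i h = let (v , vσ , iv) = support⁻ h in support⁺ (v , s v vσ , iv)

  toℕ-pt : ∀ p → toℕ (pt k p) ≡ (p ∸ 1) % n
  toℕ-pt p = toℕ-fromℕ< (m%n<n (p ∸ 1) (N k))

  sucMod-pt : ∀ p → 1 ≤ p → sucMod (pt k p) ≡ pt k (p + 1)
  sucMod-pt (suc p) _ = toℕ-injective (begin
    toℕ (sucMod (pt k (suc p)))  ≡⟨ toℕ-sucMod (pt k (suc p)) ⟩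
    suc (toℕ (pt k (suc p))) % n ≡⟨ cong (λ z → suc z % n) (toℕ-pt (suc p)) ⟩
    suc (p % n) % n              ≡⟨ suc-%-absorb p n ⟩
    suc p % n                    ≡⟨ cong (_% n) (sym (+-comm p 1)) ⟩
    (p + 1) % n                  ≡⟨ sym (toℕ-pt (suc p + 1)) ⟩
    toℕ (pt k (suc p + 1))       ∎)
    where open ≡-Reasoning

  MeetsPairOnlyAt : Subset n → Fin n → Fin n → Set
  MeetsPairOnlyAt w p x = ∀ i → i ∈ w → (i ≡ p ⊎ i ≡ sucMod p) → i ≡ x

  stable-meets-pair : ∀ (w : Subset n) (p : Fin n) → CycStable w → Σ (Fin n) (MeetsPairOnlyAt w p)
  stable-meets-pair w p st with p ∈? w
  ... | yes p∈w = p , only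
    where
    only : MeetsPairOnlyAt w p p
    only i iw (inj₁ e)    = e
    only i iw (inj₂ refl) = ⊥-elim (st (p , p∈w , iw))
  ... | no p∉w = sucMod p , only
    where
    only : MeetsPairOnlyAt w p (sucMod p)
    only i iw (inj₁ refl) = ⊥-elim (p∉w iw)
    only i iw (inj₂ e)    = e

  J⇒1≤u : ∀ {s u} → InJ k s u → 1 ≤ u
  J⇒1≤u (inj₁ (_ , 3≤u , _))    = ≤-trans (s≤s z≤n) 3≤u
  J⇒1≤u {s} (inj₂ (_ , _ , s+2≤u , _)) = ≤-trans (s≤s z≤n) (≤-trans (m≤n+m 2 s) s+2≤u)

  InC₄ : ℕ → ℕ → Fin n → Set
  InC₄ s u i = i ≡ pt k s ⊎ i ≡ pt k (s + 1) ⊎ i ≡ pt k u ⊎ i ≡ pt k (u + 1)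

  record InPData (σ : Family n) : Set where
    field
      s u      : ℕ
      1≤s      : 1 ≤ s
      s≤k+4    : s ≤ k + 4
      J        : InJ k s u
      vertices : ∀ v → v ∈F σ → IsVertex k v
      v₀       : Subset n
      v₀∈σ     : v₀ ∈F σ
      w        : Subset n
      adjacent : ∀ v → v ∈F σ → AdjS k v w
      C≡       : ∀ i → (InC k σ i → InC₄ s u i) × (InC₄ s u i → InC k σ i)

  unpack : ∀ {σ} → InP k σ → InPData σ
  unpack (s , u , (1≤s , s≤k+4) , J , ((vertices , (v₀ , v₀∈σ) , (w , adjacent)) , C≡)) =
    record { s = s ; u = u ; 1≤s = 1≤s ; s≤k+4 = s≤k+4 ; J = J ; vertices = vertices
           ; v₀ = v₀ ; v₀∈σ = v₀∈σ ; w = w ; adjacent = adjacent ; C≡ = C≡ }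

  module _ {σ : Family n} (inP : InP k σ) where
    open InPData (unpack inP)

    w⊆C : ∀ i → i ∈ w → InC₄ s u i
    w⊆C i iw = proj₁ (C≡ i) (λ (v , vσ , iv) → proj₁ (proj₂ (proj₂ (adjacent v vσ))) i iv iw)

    not-covered : ∀ i → InC₄ s u i → i ∉ support σ
    not-covered i q h = proj₂ (C≡ i) q (support⁻ h)

    -- The common neighbour w ⊆ {s, s+1, u, u+1} has three points, so it is not stable.
    neighbour-unstable : ¬ CycStable w
    neighbour-unstable st = 3≰2 (subst (_≤ 2) (proj₁ (proj₂ (adjacent v₀ v₀∈σ)))
                                       (at-most-two w (proj₁ from-s) (proj₁ from-u) two))
      where
      from-s : Σ (Fin n) (MeetsPairOnlyAt w (pt k s))
      from-s = stable-meets-pair w (pt k s) st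
      from-u : Σ (Fin n) (MeetsPairOnlyAt w (pt k u))
      from-u = stable-meets-pair w (pt k u) st
      two : ∀ i → i ∈ w → i ≡ proj₁ from-s ⊎ i ≡ proj₁ from-u
      two i iw with w⊆C i iw
      ... | inj₁ e                = inj₁ (proj₂ from-s i iw (inj₁ e))
      ... | inj₂ (inj₁ e)         = inj₁ (proj₂ from-s i iw (inj₂ (trans e (sym (sucMod-pt s 1≤s)))))
      ... | inj₂ (inj₂ (inj₁ e))  = inj₂ (proj₂ from-u i iw (inj₁ e))
      ... | inj₂ (inj₂ (inj₂ e))  = inj₂ (proj₂ from-u i iw (inj₂ (trans e (sym (sucMod-pt u (J⇒1≤u J))))))

    InP⇒𝒞 : 𝒞 (support σ) σ
    InP⇒𝒞 = (λ v vσ → (vertices v vσ , stable v vσ) , (λ i iv → support⁺ (v , vσ , iv))) ,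
            (v₀ , v₀∈σ) , (λ i h → support⁻ h)
      where
      stable : ∀ v → v ∈F σ → CycStable v
      stable v vσ with proj₂ (proj₂ (proj₂ (adjacent v vσ)))
      ... | inj₁ st = st
      ... | inj₂ st = ⊥-elim (neighbour-unstable st)

    -- Conversely every family of 𝒞(support σ) lies in P, with the same s, u and neighbour w.
    𝒞⇒InP : ∀ {τ} → 𝒞 (support σ) τ → InP k τ
    𝒞⇒InP {τ} (mem , (v₁ , v₁∈τ) , cov) =
      s , u , (1≤s , s≤k+4) , J , (((λ v vτ → proj₁ (proj₁ (mem v vτ))) , (v₁ , v₁∈τ) , (w , adjacent′)) , C≡′)
      where
      adjacent′ : ∀ v → v ∈F τ → AdjS k v w
      adjacent′ v vτ = proj₁ (proj₁ (mem v vτ)) , proj₁ (proj₂ (adjacent v₀ v₀∈σ)) , disjoint ,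
                       inj₁ (proj₂ (proj₁ (mem v vτ)))
        where
        disjoint : ∀ i → i ∈ v → i ∈ w → ⊥
        disjoint i iv iw with support⁻ (proj₂ (mem v vτ) i iv)
        ... | (v′ , v′σ , iv′) = proj₁ (proj₂ (proj₂ (adjacent v′ v′σ))) i iv′ iw
      C≡′ : ∀ i → (InC k τ i → InC₄ s u i) × (InC₄ s u i → InC k τ i)
      C≡′ i = (λ notτ → proj₁ (C≡ i) (λ (v , vσ , iv) → notτ (cov i (support⁺ (v , vσ , iv))))) ,
              (λ q (v , vτ , iv) → proj₂ (C≡ i) q (support⁻ (proj₂ (mem v vτ) i iv)))

    -- The run starts of the support are among s + 2 and u + 2, and s is outside it.
    support-FewRuns : FewRuns (support σ)
    support-FewRuns =
      at-most-two (runStarts (support σ)) (pt k ((s + 1) + 1)) (pt k ((u + 1) + 1))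
                  (λ i h → start-after-gap i (runStarts⁻ {support σ} h)) ,
      pt k s , not-covered (pt k s) (inj₁ refl)
      where
      es : sucMod (pt k s) ≡ pt k (s + 1)
      es = sucMod-pt s 1≤s
      es₁ : sucMod (pt k (s + 1)) ≡ pt k ((s + 1) + 1)
      es₁ = sucMod-pt (s + 1) (m≤n+m 1 s)
      eu : sucMod (pt k u) ≡ pt k (u + 1)
      eu = sucMod-pt u (J⇒1≤u J)
      eu₁ : sucMod (pt k (u + 1)) ≡ pt k ((u + 1) + 1)
      eu₁ = sucMod-pt (u + 1) (m≤n+m 1 u)
      after-C : ∀ i x → sucMod x ≡ i → i ∈ support σ → InC₄ s u x → i ≡ pt k ((s + 1) + 1) ⊎ i ≡ pt k ((u + 1) + 1)
      after-C i x sx i∈ (inj₁ e) =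
        ⊥-elim (not-covered i (inj₂ (inj₁ (trans (sym sx) (trans (cong sucMod e) es)))) i∈)
      after-C i x sx i∈ (inj₂ (inj₁ e)) = inj₁ (trans (sym sx) (trans (cong sucMod e) es₁))
      after-C i x sx i∈ (inj₂ (inj₂ (inj₁ e))) =
        ⊥-elim (not-covered i (inj₂ (inj₂ (inj₂ (trans (sym sx) (trans (cong sucMod e) eu))))) i∈)
      after-C i x sx i∈ (inj₂ (inj₂ (inj₂ e))) = inj₂ (trans (sym sx) (trans (cong sucMod e) eu₁))
      start-after-gap : ∀ i → RunStart (support σ) i → i ≡ pt k ((s + 1) + 1) ⊎ i ≡ pt k ((u + 1) + 1)
      start-after-gap i (i∈ , no-pred) =
        after-C i (predMod i) (sucMod-predMod i) i∈
          (proj₁ (C≡ (predMod i)) (λ cv → no-pred (predMod i) (support⁺ cv) (sucMod-predMod i)))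

-- The matching on P: on each fibre, the pivot matching of its support.

module OnP (k : ℕ) where
  open Cyclic (4 + k)
  open Covering (4 + k)
  open Fibres k

  -- ∣X∣ ≤ k + 6 pivot steps always suffice.
  fuel : ℕ
  fuel = N k

  good : ∀ X → GoodMatching X (pivotMatching fuel X)
  good = pivotMatching-good fuel

  matching : Family n → Family n → Set
  matching σ τ = InP k σ × pivotMatching fuel (support σ) σ τ

  matching-support : ∀ {σ τ} → matching σ τ → support τ ≡ support σ
  matching-support {σ} (_ , m) = support-𝒞 (proj₁ (proj₂ (GoodMatching.extends (good (support σ)) m)))

  move : ∀ {X Y σ τ} → X ≡ Y → pivotMatching fuel X σ τ → pivotMatching fuel Y σ τ
  move {σ = σ} {τ} e = subst (λ Z → pivotMatching fuel Z σ τ) e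

  -- A one-vertex extension inside P is a cover in P.
  matching-covers : ∀ σ τ → matching σ τ → Covers (InP k) σ τ
  matching-covers σ τ (inP , m) with GoodMatching.extends (good (support σ)) m
  ... | (_ , pτ , t , t∉σ , eq) = inP , 𝒞⇒InP inP pτ , (σ⊆τ , σ≢τ) , nothing-between
    where
    σ⊆τ : σ ⊆F τ
    σ⊆τ v h = subst (v ∈F_) (sym eq) (insert-⊆ t σ v h)
    σ≢τ : σ ≢ τ
    σ≢τ e = insert-≢ t σ t∉σ (trans e eq)
    nothing-between : ∀ υ → InP k υ → σ ⊂F υ → υ ⊂F τ → ⊥
    nothing-between υ _ (συ , ne₁) (υτ , ne₂) with insert-sandwich t σ υ συ (λ v h → subst (v ∈F_) eq (υτ v h))
    ... | inj₁ e = ne₁ (sym e)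
    ... | inj₂ e = ne₂ (trans e (sym eq))

  -- Every family lies in at most one pair (all pairs through it live in one fibre).
  matching-unique : ∀ σ τ σ′ τ′ x → matching σ τ → matching σ′ τ′ →
                    (x ≡ σ ⊎ x ≡ τ) → (x ≡ σ′ ⊎ x ≡ τ′) → (σ ≡ σ′ × τ ≡ τ′)
  matching-unique σ τ σ′ τ′ x p p′ (inj₁ refl) (inj₁ refl) =
    refl , GoodMatching.functional (good (support σ)) (proj₂ p) (proj₂ p′)
  matching-unique σ τ σ′ τ′ x p p′ (inj₁ refl) (inj₂ refl) =
    ⊥-elim (GoodMatching.one-role (good (support σ)) (move (sym (matching-support p′)) (proj₂ p′)) (proj₂ p))
  matching-unique σ τ σ′ τ′ x p p′ (inj₂ refl) (inj₁ refl) =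
    ⊥-elim (GoodMatching.one-role (good (support σ)) (proj₂ p) (move (matching-support p) (proj₂ p′)))
  matching-unique σ τ σ′ τ′ x p p′ (inj₂ refl) (inj₂ refl) =
    GoodMatching.injective (good (support σ)) (proj₂ p)
      (move (trans (sym (matching-support p′)) (matching-support p)) (proj₂ p′)) , refl

  matching-perfect : ∀ σ → InP k σ → ∃[ τ ] (matching σ τ ⊎ matching τ σ)
  matching-perfect σ inP
    with pivotMatching-perfect fuel (support σ) (support-FewRuns inP)
           (≤-trans (∣p∣≤n (support σ)) (m≤m+n _ 2)) (InP⇒𝒞 inP)
  ... | (τ , inj₁ m) = τ , inj₁ (inP , m)
  ... | (τ , inj₂ m) = τ , inj₂ (𝒞⇒InP inP pτ , move (sym (support-𝒞 pτ)) m)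
    where
    pτ : 𝒞 (support σ) τ
    pτ = proj₁ (GoodMatching.extends (good (support σ)) m)

  -- The support is constant along an alternating cycle, which is therefore an
  -- alternating cycle of a single pivot matching.
  matching-acyclic : IsAcyclic (InP k) matching
  matching-acyclic m₀ σ τ distinct matched covered =
    GoodMatching.acyclic (good X₀) m₀ σ τ distinct matched′ covered′
    where
    X₀ : Subset n
    X₀ = support (σ F.zero)
    support-descends : ∀ i → support (σ (sucMod i)) ⊆ₛ support (σ i)
    support-descends i j h =
      subst (j ∈_) (matching-support (matched i)) (support-mono (proj₁ (proj₁ (proj₂ (proj₂ (covered i))))) j h)
    same-support : ∀ i → support (σ i) ≡ X₀
    same-support i = SP.⊆-antisym (λ {x} → below F.zero i x) (λ {x} → below i F.zero x)
      where
      below : ∀ i j → support (σ j) ⊆ₛ support (σ i)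
      below = Cyclic.cyclic-descent m₀ _⊆ₛ_ (λ h g x xh → g x (h x xh)) (λ i → support (σ i))
                support-descends (λ x h → h)
    matched′ : ∀ i → pivotMatching fuel X₀ (σ i) (τ i)
    matched′ i = move (same-support i) (proj₂ (matched i))
    covered′ : ∀ i → Covers (𝒞 X₀) (σ (sucMod i)) (τ i)
    covered′ i = proj₁ (GoodMatching.extends (good X₀) (matched′ (sucMod i))) ,
                 proj₁ (proj₂ (GoodMatching.extends (good X₀) (matched′ i))) ,
                 proj₁ (proj₂ (proj₂ (covered i))) ,
                 (λ υ pυ → proj₂ (proj₂ (proj₂ (covered i))) υ (𝒞⇒InP (proj₁ (matched F.zero)) pυ))

lemma3p6 : (k : ℕ) →
    Σ (Family (N k) → Family (N k) → Set) (IsPerfectAcyclicMatching (InP k))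
lemma3p6 k = matching , (matching-covers , matching-unique) , matching-perfect , matching-acyclic
  where open OnP k
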